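{- Let $p\geq 2$ be an integer. For every $n\geq 12$, $t_p(n,P_5)=e_p(H(n,5))$, and $H(n,5)$ is the unique $n$-vertex $P_5$-free graph $G$ with $e_p(G)=t_p(n,P_5)$.
   Context: All graphs are finite, simple, undirected. For a graph $G$ with degree sequence $d_1,\ldots,d_n$, $e_p(G)=\sum_{i=1}^n d_i^p$. For a fixed graph $H$, $t_p(n,H)$ is the maximum of $e_p(G)$ over all $n$-vertex graphs not containing $H$ as a subgraph. $P_5$ is the path with 5 vertices. $H(n,5)$ (for $n\geq 3$) is the star with $n$ vertices together with one additional edge joining two of its leaves. -}

module Defs where

open import Data.Nat using (ℕ; zero; suc; _+_; _^_; _≤_)
open import Data.Bool using (Bool; true; false; if_then_else_)
open import Data.Fin using (Fin; toℕ)
open import Data.List using (List; map; allFin)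
open import Data.Nat.ListAction using (sum)
open import Data.Product using (Σ; _×_)
open import Function.Definitions using (Injective)
open import Function.Bundles using (_↔_; Inverse)
open import Relation.Binary.PropositionalEquality using (_≡_; refl)

record Graph (n : ℕ) : Set where
  field
    adj    : Fin n → Fin n → Bool
    sym    : ∀ i j → adj i j ≡ adj j i
    irrefl : ∀ i → adj i i ≡ false
open Graph public

deg : ∀ {n} → Graph n → Fin n → ℕ
deg {n} G i = sum (map (λ j → if adj G i j then 1 else 0) (allFin n))

e : ℕ → ∀ {n} → Graph n → ℕ
e p {n} G = sum (map (λ i → deg G i ^ p) (allFin n))

Contains : ∀ {n k} → Graph n → Graph k → Set
Contains {n} {k} G H =
  Σ (Fin k → Fin n) λ f →
    Injective _≡_ _≡_ f × (∀ i j → adj H i j ≡ true → adj G (f i) (f j) ≡ true)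

Free : ∀ {n k} → Graph k → Graph n → Set
Free H G = Contains G H → Data.Empty.⊥
  where import Data.Empty

_≅_ : ∀ {n} → Graph n → Graph n → Set
_≅_ {n} G H = Σ (Fin n ↔ Fin n) λ σ → ∀ i j → adj G i j ≡ adj H (Inverse.to σ i) (Inverse.to σ j)

-- Path graph P_k on vertices 0,1,...,k-1 with edges {i,i+1}
pathℕ : ℕ → ℕ → Bool
pathℕ (suc a) (suc b) = pathℕ a b
pathℕ zero zero = false
pathℕ zero (suc zero) = true
pathℕ zero (suc (suc _)) = false
pathℕ (suc zero) zero = true
pathℕ (suc (suc _)) zero = false

pathℕ-sym : ∀ a b → pathℕ a b ≡ pathℕ b a
pathℕ-sym zero zero = refl
pathℕ-sym zero (suc zero) = refl
pathℕ-sym zero (suc (suc b)) = refl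
pathℕ-sym (suc zero) zero = refl
pathℕ-sym (suc (suc a)) zero = refl
pathℕ-sym (suc a) (suc b) = pathℕ-sym a b

pathℕ-irrefl : ∀ a → pathℕ a a ≡ false
pathℕ-irrefl zero = refl
pathℕ-irrefl (suc a) = pathℕ-irrefl a

P : (k : ℕ) → Graph k
P k = record
  { adj = λ i j → pathℕ (toℕ i) (toℕ j)
  ; sym = λ i j → pathℕ-sym (toℕ i) (toℕ j)
  ; irrefl = λ i → pathℕ-irrefl (toℕ i)
  }

-- H(n,5): star with centre 0 and leaves 1..n-1, plus the edge {1,2}
leafEdge : ℕ → ℕ → Bool
leafEdge (suc _) (suc _) = false
leafEdge zero zero = false
leafEdge zero (suc zero) = true
leafEdge zero (suc (suc _)) = false
leafEdge (suc zero) zero = true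
leafEdge (suc (suc _)) zero = false

hℕ : ℕ → ℕ → Bool
hℕ zero zero = false
hℕ zero (suc _) = true
hℕ (suc _) zero = true
hℕ (suc a) (suc b) = leafEdge a b

leafEdge-sym : ∀ a b → leafEdge a b ≡ leafEdge b a
leafEdge-sym zero zero = refl
leafEdge-sym zero (suc zero) = refl
leafEdge-sym zero (suc (suc b)) = refl
leafEdge-sym (suc zero) zero = refl
leafEdge-sym (suc (suc a)) zero = refl
leafEdge-sym (suc a) (suc b) = refl

hℕ-sym : ∀ a b → hℕ a b ≡ hℕ b a
hℕ-sym zero zero = refl
hℕ-sym zero (suc b) = refl
hℕ-sym (suc a) zero = refl
hℕ-sym (suc a) (suc b) = leafEdge-sym a b

hℕ-irrefl : ∀ a → hℕ a a ≡ false
hℕ-irrefl zero = refl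
hℕ-irrefl (suc zero) = refl
hℕ-irrefl (suc (suc a)) = refl

H5 : (n : ℕ) → Graph n
H5 n = record
  { adj = λ i j → hℕ (toℕ i) (toℕ j)
  ; sym = λ i j → hℕ-sym (toℕ i) (toℕ j)
  ; irrefl = λ i → hℕ-irrefl (toℕ i)
  }

-- Let F(t) = (t − 1)^p + 2·2^p + (t − 3) = e_p(H(t,5)) and Φ(k) = max(F(k), 3^p k) for k ≥ 1.
-- Every P₅-free graph on k vertices has e_p ≤ Φ(k), by induction on k.  If all degrees are at
-- most 3 this is immediate.  Otherwise P₅-freeness forces a vertex x of degree ≥ 4 to lie in a
-- union T of components that is either a double star (x, one neighbour u of x, and leaves) or
-- the closed neighbourhood of x with at most one edge among the neighbours; in both cases
-- e_p(T) ≤ F(|T|), strictly unless T spans H(|T|,5).  As F(a) + Φ(b) < F(a + b) for a ≥ 5,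
-- b ≥ 1, the induction closes, and since 3^p k < F(k) for k ≥ 12 the bound at n ≥ 12 is F(n),
-- attained only when T is the whole graph and the graph is H(n,5).

module Submission where

open import Defs hiding (sym)
open import Data.Bool using (Bool; true; false; if_then_else_; _∧_; _∨_; not)
open import Data.Bool.Properties using (∧-conicalˡ; ∧-conicalʳ; ∧-zeroʳ; ∨-zeroʳ; ¬-not) renaming (_≟_ to _≟ᵇ_)
open import Data.Empty using (⊥; ⊥-elim)
open import Data.Fin using (Fin; zero; suc; toℕ; inject₁; fromℕ<)
open import Data.Fin.Patterns using (0F; 1F; 2F; 3F; 4F)
open import Data.Fin.Permutation using (Permutation′; _⟨$⟩ʳ_; _⟨$⟩ˡ_; _∘ₚ_; transpose; inverseˡ)
open import Data.Fin.Properties using (_≟_; any?; pigeonhole; toℕ-fromℕ<; toℕ-injective; inject₁-injective)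
import Data.Fin.Properties as Fin
open import Data.List using (List; []; _∷_; length; map; allFin; tabulate)
import Data.List.Membership.DecPropositional as DecMembership
open import Data.List.Membership.Propositional using (_∈_; _∉_)
open import Data.List.Properties using (map-tabulate)
open import Data.List.Relation.Unary.Any using (here; there)
open import Data.Nat using (ℕ; zero; suc; _+_; _*_; _∸_; _^_; _⊔_; _≤_; _<_; _≤?_; _<?_; z≤n; s≤s)
import Data.Nat.ListAction as List
open import Data.Nat.Properties hiding (_≟_)
open import Data.Nat.Tactic.RingSolver using (solve-∀)
open import Data.Product using (∃; _×_; _,_; proj₁; proj₂)
open import Data.Sum using (_⊎_; inj₁; inj₂)
import Data.Sum as Sum
open import Data.Vec using (Vec; lookup; []; _∷_)
open import Data.Vec.Relation.Unary.All using ([]; _∷_)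
open import Data.Vec.Relation.Unary.AllPairs using ([]; _∷_)
open import Data.Vec.Relation.Unary.Unique.Propositional using (Unique)
open import Data.Vec.Relation.Unary.Unique.Propositional.Properties using (lookup-injective)
open import Function using (id; _∘_)
open import Function.Definitions using (Injective)
open import Relation.Binary.PropositionalEquality
open import Relation.Nullary using (Dec; does; yes; no; ¬_; ¬?)
open import Relation.Nullary.Decidable using (_×-dec_; dec-true; decidable-stable)

open import Algebra.Properties.Semiring.Sum +-*-semiring
  using (sum-syntax; ∑-distrib-+; *-distribˡ-sum; sum-cong-≗) renaming (sum to ∑)

⟦_⟧ : Bool → ℕ
⟦ b ⟧ = if b then 1 else 0

δ : ∀ {n} → Fin n → Fin n → ℕ
δ i j = ⟦ does (i ≟ j) ⟧

sum-map-allFin : ∀ {n} (f : Fin n → ℕ) → List.sum (map f (allFin n)) ≡ ∑ f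
sum-map-allFin f = trans (cong List.sum (map-tabulate id f)) (sum-tabulate f)
  where
  sum-tabulate : ∀ {n} (f : Fin n → ℕ) → List.sum (tabulate f) ≡ ∑ f
  sum-tabulate {zero} f = refl
  sum-tabulate {suc n} f = cong (f zero +_) (sum-tabulate (λ i → f (suc i)))

∑-mono-≤ : ∀ {n} {f g : Fin n → ℕ} → (∀ i → f i ≤ g i) → ∑ f ≤ ∑ g
∑-mono-≤ {zero} f≤g = z≤n
∑-mono-≤ {suc n} f≤g = +-mono-≤ (f≤g zero) (∑-mono-≤ (λ i → f≤g (suc i)))

f≤∑f : ∀ {n} (f : Fin n → ℕ) i → f i ≤ ∑ f
f≤∑f f zero = m≤m+n (f zero) _
f≤∑f f (suc i) = ≤-trans (f≤∑f (λ j → f (suc j)) i) (m≤n+m _ (f zero))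

∑-const : ∀ n c → ∑[ i < n ] c ≡ n * c
∑-const zero c = refl
∑-const (suc n) c = cong (c +_) (∑-const n c)

∑-δ : ∀ {n} (j : Fin n) → ∑[ i < n ] δ i j ≡ 1
∑-δ {suc n} zero = cong suc (trans (∑-const n 0) (*-zeroʳ n))
∑-δ {suc n} (suc j) = ∑-δ j

∑[cδ+f]≡c+∑f : ∀ {n} c (j : Fin n) (f : Fin n → ℕ) → ∑[ i < n ] (c * δ i j + f i) ≡ c + ∑ f
∑[cδ+f]≡c+∑f c j f = trans (∑-distrib-+ (λ i → c * δ i j) f) (cong (_+ ∑ f) ∑cδ≡c)
  where
  ∑cδ≡c : ∑ (λ i → c * δ i j) ≡ c
  ∑cδ≡c = trans (sym (*-distribˡ-sum c (λ i → δ i j))) (trans (cong (c *_) (∑-δ j)) (*-identityʳ c))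

δ-refl : ∀ {n} (i : Fin n) → δ i i ≡ 1
δ-refl i with i ≟ i
... | yes _ = refl
... | no i≢i = ⊥-elim (i≢i refl)

m≤c*δii : ∀ {n m c} (i : Fin n) → m ≤ c → m ≤ c * δ i i
m≤c*δii {c = c} i m≤c = ≤-trans m≤c (≤-reflexive (sym (trans (cong (c *_) (δ-refl i)) (*-identityʳ c))))

multiplicity : ∀ {n} → List (Fin n) → Fin n → ℕ
multiplicity [] i = 0
multiplicity (j ∷ js) i = δ i j + multiplicity js i

∑-multiplicity : ∀ {n} (js : List (Fin n)) → ∑[ i < n ] multiplicity js i ≡ length js
∑-multiplicity {n} [] = trans (∑-const n 0) (*-zeroʳ n)
∑-multiplicity (j ∷ js) =
  trans (∑-distrib-+ (λ i → δ i j) (multiplicity js)) (cong₂ _+_ (∑-δ j) (∑-multiplicity js))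

∈⇒1≤multiplicity : ∀ {n} {i : Fin n} {js} → i ∈ js → 1 ≤ multiplicity js i
∈⇒1≤multiplicity {i = i} (here refl) = ≤-trans (≤-reflexive (sym (δ-refl i))) (m≤m+n (δ i i) _)
∈⇒1≤multiplicity (there i∈js) = ≤-trans (∈⇒1≤multiplicity i∈js) (m≤n+m _ _)

-- H(t,5) has degrees t − 1 (the centre), 2, 2 and 1 (the other t − 3 leaves).
F : ℕ → ℕ → ℕ
F p t = (t ∸ 1) ^ p + 2 * 2 ^ p + (t ∸ 3)

Φ : ℕ → ℕ → ℕ
Φ p zero = 0
Φ p (suc k) = F p (suc k) ⊔ 3 ^ p * suc k

a^[2+q]≡a*a*a^q : ∀ a q → a ^ (2 + q) ≡ a * a * a ^ q
a^[2+q]≡a*a*a^q a q = sym (*-assoc a a (a ^ q))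

x^p+y^p+2xy[x+y]^q≤[x+y]^p : ∀ x y q →
  x ^ (2 + q) + y ^ (2 + q) + 2 * x * y * (x + y) ^ q ≤ (x + y) ^ (2 + q)
x^p+y^p+2xy[x+y]^q≤[x+y]^p x y q = begin
  x ^ (2 + q) + y ^ (2 + q) + 2 * x * y * s ^ q
    ≡⟨ cong₂ (λ u v → u + v + 2 * x * y * s ^ q) (a^[2+q]≡a*a*a^q x q) (a^[2+q]≡a*a*a^q y q) ⟩
  x * x * x ^ q + y * y * y ^ q + 2 * x * y * s ^ q
    ≤⟨ +-monoˡ-≤ (2 * x * y * s ^ q) (+-mono-≤ (*-monoʳ-≤ (x * x) (^-monoˡ-≤ q (m≤m+n x y)))
                                               (*-monoʳ-≤ (y * y) (^-monoˡ-≤ q (m≤n+m y x)))) ⟩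
  x * x * s ^ q + y * y * s ^ q + 2 * x * y * s ^ q
    ≡⟨ square x y (s ^ q) ⟩
  s * s * s ^ q
    ≡⟨ sym (a^[2+q]≡a*a*a^q s q) ⟩
  s ^ (2 + q) ∎
  where
  open ≤-Reasoning
  s : ℕ
  s = x + y
  square : ∀ x y z → x * x * z + y * y * z + 2 * x * y * z ≡ (x + y) * (x + y) * z
  square = solve-∀

a^p+b^p≤[a+b∸1]^p : ∀ q {a b} → 2 ≤ a → 2 ≤ b → a ^ (2 + q) + b ^ (2 + q) ≤ (a + b ∸ 1) ^ (2 + q)
a^p+b^p≤[a+b∸1]^p q {a@(suc (suc a'))} {b@(suc (suc b'))} (s≤s (s≤s _)) (s≤s (s≤s _)) = begin
  a ^ (2 + q) + b ^ (2 + q)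
    ≡⟨ cong₂ _+_ (a^[2+q]≡a*a*a^q a q) (a^[2+q]≡a*a*a^q b q) ⟩
  a * a * a ^ q + b * b * b ^ q
    ≤⟨ +-mono-≤ (*-monoʳ-≤ (a * a) (^-monoˡ-≤ q a≤c)) (*-monoʳ-≤ (b * b) (^-monoˡ-≤ q b≤c)) ⟩
  a * a * c ^ q + b * b * c ^ q
    ≤⟨ m≤m+n _ _ ⟩
  a * a * c ^ q + b * b * c ^ q + (1 + 2 * a' + 2 * b' + 2 * a' * b') * c ^ q
    ≡⟨ square a' b' (c ^ q) ⟩
  c * c * c ^ q
    ≡⟨ sym (a^[2+q]≡a*a*a^q c q) ⟩
  c ^ (2 + q) ∎
  where
  open ≤-Reasoning
  c : ℕ
  c = a + b ∸ 1
  a≤c : a ≤ c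
  a≤c = s≤s (subst (suc a' ≤_) (sym (+-suc a' (suc b'))) (s≤s (m≤m+n a' (suc b'))))
  b≤c : b ≤ c
  b≤c = s≤s (≤-trans (n≤1+n (suc b')) (m≤n+m (suc (suc b')) a'))
  square : ∀ a' b' z → (2 + a') * (2 + a') * z + (2 + b') * (2 + b') * z + (1 + 2 * a' + 2 * b' + 2 * a' * b') * z
                     ≡ (1 + a' + (2 + b')) * (1 + a' + (2 + b')) * z
  square = solve-∀

9*3^q≤1+8*5^q : ∀ q → 9 * 3 ^ q ≤ 1 + 8 * 5 ^ q
9*3^q≤1+8*5^q zero = ≤-refl
9*3^q≤1+8*5^q (suc q) with 5 ^ q | m^n>0 5 q | 9*3^q≤1+8*5^q q
... | suc w | _ | ih = begin
  9 * (3 * 3 ^ q)                     ≡⟨ shuffle (3 ^ q) ⟩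
  3 * (9 * 3 ^ q)                     ≤⟨ *-monoʳ-≤ 3 ih ⟩
  3 * (1 + 8 * suc w)                 ≤⟨ m≤m+n _ _ ⟩
  3 * (1 + 8 * suc w) + (14 + 16 * w) ≡⟨ expand w ⟩
  1 + 8 * (5 * suc w)                 ∎
  where
  open ≤-Reasoning
  shuffle : ∀ z → 9 * (3 * z) ≡ 3 * (9 * z)
  shuffle = solve-∀
  expand : ∀ w → 3 * (1 + 8 * suc w) + (14 + 16 * w) ≡ 1 + 8 * (5 * suc w)
  expand = solve-∀

4≤2*2^[2+q] : ∀ q → 4 ≤ 2 * 2 ^ (2 + q)
4≤2*2^[2+q] q = *-monoʳ-≤ 2 (*-monoʳ-≤ 2 (≤-trans (m^n>0 2 q) (m≤m+n (2 ^ q) _)))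

2*2^p≤2xy[x+y]^q : ∀ q {x y} → 4 ≤ x → 1 ≤ y → 2 * 2 ^ (2 + q) ≤ 2 * x * y * (x + y) ^ q
2*2^p≤2xy[x+y]^q q {x} {y} 4≤x 1≤y = begin
  2 * 2 ^ (2 + q)        ≡⟨ eight (2 ^ q) ⟩
  8 * 2 ^ q              ≤⟨ *-mono-≤ (*-mono-≤ (*-monoʳ-≤ 2 4≤x) 1≤y) (^-monoˡ-≤ q 2≤x+y) ⟩
  2 * x * y * (x + y) ^ q ∎
  where
  open ≤-Reasoning
  2≤x+y : 2 ≤ x + y
  2≤x+y = ≤-trans (≤-trans (s≤s (s≤s z≤n)) 4≤x) (m≤m+n x y)
  eight : ∀ z → 2 * (2 * (2 * z)) ≡ 8 * z
  eight = solve-∀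

F-superadditive : ∀ q {a b} → 5 ≤ a → 1 ≤ b → F (2 + q) a + F (2 + q) b < F (2 + q) (a + b)
F-superadditive q {suc (suc (suc (suc (suc t))))} {suc r} (s≤s (s≤s (s≤s (s≤s (s≤s _))))) (s≤s _) = begin-strict
  X + W + (2 + t) + (r ^ p + W + (suc r ∸ 3))  ≡⟨ regroup X W (2 + t) (r ^ p) (suc r ∸ 3) ⟩
  (X + r ^ p + W) + (W + (2 + t) + (suc r ∸ 3))
    <⟨ +-mono-≤-< powers (+-monoʳ-< (W + (2 + t)) (s≤s (m∸n≤m r 2))) ⟩
  (x + y) ^ p + (W + (2 + t) + suc r)           ≡⟨ reassoc ((x + y) ^ p) W (2 + t) (suc r) ⟩
  (x + y) ^ p + W + (2 + t + suc r)             ∎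
  where
  open ≤-Reasoning
  p x y X W : ℕ
  p = 2 + q
  x = 4 + t
  y = suc r
  X = x ^ p
  W = 2 * 2 ^ p
  powers : X + r ^ p + W ≤ (x + y) ^ p
  powers = begin
    X + r ^ p + W                       ≤⟨ +-mono-≤ (+-monoʳ-≤ X (^-monoˡ-≤ p (n≤1+n r)))
                                                    (2*2^p≤2xy[x+y]^q q (m≤m+n 4 t) (s≤s z≤n)) ⟩
    X + y ^ p + 2 * x * y * (x + y) ^ q ≤⟨ x^p+y^p+2xy[x+y]^q≤[x+y]^p x y q ⟩
    (x + y) ^ p                         ∎
  regroup : ∀ X W a R b → X + W + a + (R + W + b) ≡ (X + R + W) + (W + a + b)
  regroup = solve-∀
  reassoc : ∀ C W a b → C + (W + a + b) ≡ C + W + (a + b)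
  reassoc = solve-∀

F+3^pb<F : ∀ q {a b} → 5 ≤ a → 1 ≤ b → F (2 + q) a + 3 ^ (2 + q) * b < F (2 + q) (a + b)
F+3^pb<F q {suc (suc (suc (suc (suc t))))} {suc r} (s≤s (s≤s (s≤s (s≤s (s≤s _))))) (s≤s _) = begin-strict
  X + W + (2 + t) + 3 ^ p * y               ≡⟨ regroup X W (2 + t) (3 ^ p * y) ⟩
  (X + 3 ^ p * y) + (W + (2 + t))
    <⟨ +-mono-≤-< powers (+-monoʳ-< W (m≤m+n (3 + t) r)) ⟩
  (x + y) ^ p + (W + (3 + t + r))           ≡⟨ reassoc ((x + y) ^ p) W t r ⟩
  (x + y) ^ p + W + (2 + t + suc r)         ∎
  where
  open ≤-Reasoning
  p x y X W : ℕ
  p = 2 + q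
  x = 4 + t
  y = suc r
  X = x ^ p
  W = 2 * 2 ^ p
  linear : 3 ^ p * y ≤ y ^ p + 2 * x * y * (x + y) ^ q
  linear = begin
    3 ^ p * y                            ≡⟨ nine (3 ^ q) y ⟩
    y * (9 * 3 ^ q)                      ≤⟨ *-monoʳ-≤ y (9*3^q≤1+8*5^q q) ⟩
    y * (1 + 8 * 5 ^ q)                  ≡⟨ distrib y (5 ^ q) ⟩
    y + 8 * y * 5 ^ q                    ≤⟨ +-mono-≤ y≤y^p (*-mono-≤ (*-monoˡ-≤ y (*-monoʳ-≤ 2 (m≤m+n 4 t)))
                                                                  (^-monoˡ-≤ q 5≤x+y)) ⟩
    y ^ p + 2 * x * y * (x + y) ^ q      ∎
    where
    y≤y^p : y ≤ y ^ p
    y≤y^p = subst (_≤ y ^ p) (*-identityʳ y) (*-monoʳ-≤ y (m^n>0 y (suc q)))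
    5≤x+y : 5 ≤ x + y
    5≤x+y = s≤s (s≤s (s≤s (s≤s (≤-trans (s≤s z≤n) (m≤n+m y t)))))
    nine : ∀ z y → 3 * (3 * z) * y ≡ y * (9 * z)
    nine = solve-∀
    distrib : ∀ y z → y * (1 + 8 * z) ≡ y + 8 * y * z
    distrib = solve-∀
  powers : X + 3 ^ p * y ≤ (x + y) ^ p
  powers = begin
    X + 3 ^ p * y                         ≤⟨ +-monoʳ-≤ X linear ⟩
    X + (y ^ p + 2 * x * y * (x + y) ^ q) ≡⟨ sym (+-assoc X _ _) ⟩
    X + y ^ p + 2 * x * y * (x + y) ^ q   ≤⟨ x^p+y^p+2xy[x+y]^q≤[x+y]^p x y q ⟩
    (x + y) ^ p                           ∎
  regroup : ∀ X W a T → X + W + a + T ≡ (X + T) + (W + a)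
  regroup = solve-∀
  reassoc : ∀ C W t r → C + (W + (3 + t + r)) ≡ C + W + (2 + t + suc r)
  reassoc = solve-∀

F≤Φ : ∀ p {k} → 1 ≤ k → F p k ≤ Φ p k
F≤Φ p (s≤s _) = m≤m⊔n _ _

3^pk≤Φ : ∀ p k → 3 ^ p * k ≤ Φ p k
3^pk≤Φ p zero = ≤-reflexive (*-zeroʳ (3 ^ p))
3^pk≤Φ p (suc k) = m≤n⊔m _ _

F+Φ<F : ∀ q {a b} → 5 ≤ a → 1 ≤ b → F (2 + q) a + Φ (2 + q) b < F (2 + q) (a + b)
F+Φ<F q {a} {suc b} 5≤a 1≤b = begin-strict
  F p a + (F p (suc b) ⊔ 3 ^ p * suc b)            ≡⟨ +-distribˡ-⊔ (F p a) _ _ ⟩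
  (F p a + F p (suc b)) ⊔ (F p a + 3 ^ p * suc b)  <⟨ ⊔-lub (F-superadditive q 5≤a 1≤b) (F+3^pb<F q 5≤a 1≤b) ⟩
  F p (a + suc b)                                  ∎
  where
  open ≤-Reasoning
  p : ℕ
  p = 2 + q

F+Φ≤Φ : ∀ q {a} b → 5 ≤ a → F (2 + q) a + Φ (2 + q) b ≤ Φ (2 + q) (a + b)
F+Φ≤Φ q {a} zero 5≤a =
  subst₂ _≤_ (sym (+-identityʳ _)) (cong (Φ (2 + q)) (sym (+-identityʳ a))) (F≤Φ (2 + q) (≤-trans (s≤s z≤n) 5≤a))
F+Φ≤Φ q {a} (suc b) 5≤a =
  ≤-trans (<⇒≤ (F+Φ<F q 5≤a (s≤s z≤n))) (F≤Φ (2 + q) (≤-trans (s≤s z≤n) (m≤n+m (suc b) a)))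

3^pt<F : ∀ q {t} → 12 ≤ t → 3 ^ (2 + q) * t < F (2 + q) t
3^pt<F q {t} 12≤t = subst (λ t → 3 ^ (2 + q) * t < F (2 + q) t) (m+[n∸m]≡n 12≤t) (bound (t ∸ 12))
  where
  open ≤-Reasoning
  p : ℕ
  p = 2 + q
  bound : ∀ m → 3 ^ p * (12 + m) < F p (12 + m)
  bound m = begin-strict
    3 ^ p * (12 + m)                                      ≡⟨ nine (3 ^ q) m ⟩
    9 * (12 + m) * 3 ^ q                                  ≤⟨ *-mono-≤ (m≤m+n (9 * (12 + m)) (13 + 13 * m + m * m))
                                                                      (^-monoˡ-≤ q (m≤m+n 3 (8 + m))) ⟩
    (9 * (12 + m) + (13 + 13 * m + m * m)) * (11 + m) ^ q ≡⟨ cong (_* (11 + m) ^ q) (square m) ⟩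
    (11 + m) * (11 + m) * (11 + m) ^ q                    ≡⟨ sym (a^[2+q]≡a*a*a^q (11 + m) q) ⟩
    (11 + m) ^ p                                          <⟨ m<m+n _ (≤-trans (s≤s z≤n) (m≤n+m (9 + m) (2 * 2 ^ p))) ⟩
    (11 + m) ^ p + (2 * 2 ^ p + (9 + m))                  ≡⟨ sym (+-assoc ((11 + m) ^ p) _ _) ⟩
    F p (12 + m)                                          ∎
    where
    nine : ∀ z m → 3 * (3 * z) * (12 + m) ≡ 9 * (12 + m) * z
    nine = solve-∀
    square : ∀ m → 9 * (12 + m) + (13 + 13 * m + m * m) ≡ (11 + m) * (11 + m)
    square = solve-∀

Φ≡F : ∀ q {t} → 12 ≤ t → Φ (2 + q) t ≡ F (2 + q) t
Φ≡F q {suc t} 12≤t = m≥n⇒m⊔n≡m (<⇒≤ (3^pt<F q 12≤t))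

Δ^p+Δ<F[1+Δ] : ∀ q Δ → Δ ^ (2 + q) + Δ < F (2 + q) (1 + Δ)
Δ^p+Δ<F[1+Δ] q Δ = begin-strict
  Δ ^ p + Δ                     <⟨ +-monoʳ-< (Δ ^ p) Δ<W+[Δ∸2] ⟩
  Δ ^ p + (2 * 2 ^ p + (Δ ∸ 2)) ≡⟨ sym (+-assoc (Δ ^ p) _ _) ⟩
  F p (1 + Δ)                   ∎
  where
  open ≤-Reasoning
  p : ℕ
  p = 2 + q
  Δ<W+[Δ∸2] : Δ < 2 * 2 ^ p + (Δ ∸ 2)
  Δ<W+[Δ∸2] = begin-strict
    Δ                     ≤⟨ m≤n+m∸n Δ 2 ⟩
    2 + (Δ ∸ 2)           <⟨ +-monoˡ-< (Δ ∸ 2) (≤-trans (s≤s (s≤s (s≤s z≤n))) (4≤2*2^[2+q] q)) ⟩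
    2 * 2 ^ p + (Δ ∸ 2)   ∎

F[1+Δ]≡Δ^p+Δ+2[2^p∸1] : ∀ q {Δ} → 2 ≤ Δ → F (2 + q) (1 + Δ) ≡ Δ ^ (2 + q) + Δ + 2 * (2 ^ (2 + q) ∸ 1)
F[1+Δ]≡Δ^p+Δ+2[2^p∸1] q {suc (suc a)} (s≤s (s≤s _)) with 2 ^ (2 + q) | m^n>0 2 (2 + q)
... | suc w | _ = regroup ((2 + a) ^ (2 + q)) a w
  where
  regroup : ∀ X a w → X + 2 * suc w + a ≡ X + (2 + a) + 2 * w
  regroup = solve-∀

Δ^p+d^p+t<F : ∀ q {Δ d t} → 2 ≤ Δ → 2 ≤ d → Δ + d ≤ t → Δ ^ (2 + q) + d ^ (2 + q) + t < F (2 + q) t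
Δ^p+d^p+t<F q {Δ} {d} {t} 2≤Δ 2≤d Δ+d≤t = begin-strict
  Δ ^ p + d ^ p + t                  <⟨ +-mono-≤-< powers t<W+[t∸3] ⟩
  (t ∸ 1) ^ p + (2 * 2 ^ p + (t ∸ 3)) ≡⟨ sym (+-assoc ((t ∸ 1) ^ p) _ _) ⟩
  F p t                              ∎
  where
  open ≤-Reasoning
  p : ℕ
  p = 2 + q
  powers : Δ ^ p + d ^ p ≤ (t ∸ 1) ^ p
  powers = ≤-trans (a^p+b^p≤[a+b∸1]^p q 2≤Δ 2≤d) (^-monoˡ-≤ p (∸-monoˡ-≤ 1 Δ+d≤t))
  t<W+[t∸3] : t < 2 * 2 ^ p + (t ∸ 3)
  t<W+[t∸3] = begin-strict
    t                   ≤⟨ m≤n+m∸n t 3 ⟩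
    3 + (t ∸ 3)         <⟨ +-monoˡ-< (t ∸ 3) (4≤2*2^[2+q] q) ⟩
    2 * 2 ^ p + (t ∸ 3) ∎

∧-intro : ∀ {x y} → x ≡ true → y ≡ true → x ∧ y ≡ true
∧-intro refl refl = refl

∧-elim : ∀ {x y} → x ∧ y ≡ true → x ≡ true × y ≡ true
∧-elim {x} {y} x∧y = ∧-conicalˡ x y x∧y , ∧-conicalʳ x y x∧y

∨-elim : ∀ {x y} → x ∨ y ≡ true → x ≡ true ⊎ y ≡ true
∨-elim {true} _ = inj₁ refl
∨-elim {false} y = inj₂ y

∨-introˡ : ∀ {x} y → x ≡ true → x ∨ y ≡ true
∨-introˡ _ refl = refl

∨-introʳ : ∀ x {y} → y ≡ true → x ∨ y ≡ true
∨-introʳ x refl = ∨-zeroʳ x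

does-true : ∀ {A : Set} (a? : Dec A) → does a? ≡ true → A
does-true (yes a) _ = a

⟦⟧+⟦⟧≤ : ∀ b c d → (b ≡ true → c ≡ true → ⊥) → (b ≡ true → d ≡ true) → (c ≡ true → d ≡ true) →
          ⟦ b ⟧ + ⟦ c ⟧ ≤ ⟦ d ⟧
⟦⟧+⟦⟧≤ true true d disjoint _ _ = ⊥-elim (disjoint refl refl)
⟦⟧+⟦⟧≤ true false d _ b⇒d _ rewrite b⇒d refl = ≤-refl
⟦⟧+⟦⟧≤ false true d _ _ c⇒d rewrite c⇒d refl = ≤-refl
⟦⟧+⟦⟧≤ false false d _ _ _ = z≤n

⟦⟧≤ : ∀ b {c} → (b ≡ true → 1 ≤ c) → ⟦ b ⟧ ≤ c
⟦⟧≤ true 1≤c = 1≤c refl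
⟦⟧≤ false _ = z≤n

pathℕ-step : ∀ {k} (i j : Fin (suc k)) → pathℕ (toℕ i) (toℕ j) ≡ true →
  (∃ λ l → i ≡ inject₁ l × j ≡ suc l) ⊎ (∃ λ l → j ≡ inject₁ l × i ≡ suc l)
pathℕ-step zero (suc zero) _ = inj₁ (zero , refl , refl)
pathℕ-step (suc zero) zero _ = inj₂ (zero , refl , refl)
pathℕ-step {suc k} (suc i) (suc j) i~j with pathℕ-step i j i~j
... | inj₁ (l , refl , refl) = inj₁ (suc l , refl , refl)
... | inj₂ (l , refl , refl) = inj₂ (suc l , refl , refl)
pathℕ-step zero zero ()
pathℕ-step zero (suc (suc _)) ()
pathℕ-step (suc (suc _)) zero ()

VertexSet : ℕ → Set
VertexSet n = Fin n → Bool

∣_∣ : ∀ {n} → VertexSet n → ℕ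
∣ S ∣ = ∑ (λ v → ⟦ S v ⟧)

full : ∀ {n} → VertexSet n
full _ = true

∣full∣≡n : ∀ {n} → ∣ full {n} ∣ ≡ n
∣full∣≡n {n} = trans (∑-const n 1) (*-identityʳ n)

_∖_ : ∀ {n} → VertexSet n → VertexSet n → VertexSet n
(S ∖ T) v = S v ∧ not (T v)

module InducedSubgraph {n} (G : Graph n) where

  open DecMembership (_≟_ {n}) using (_∈?_)

  infix 4 _~_
  _~_ : Fin n → Fin n → Set
  u ~ v = adj G u v ≡ true

  ~-sym : ∀ {u v} → u ~ v → v ~ u
  ~-sym {u} {v} u~v = trans (Graph.sym G v u) u~v

  ~⇒≢ : ∀ {u v} → u ~ v → u ≢ v
  ~⇒≢ {u} u~v refl with trans (sym u~v) (irrefl G u)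
  ... | ()

  ≁⇒≢ : ∀ {x v w} → ¬ x ~ v → x ~ w → v ≢ w
  ≁⇒≢ x≁v x~w refl = x≁v x~w

  unique-walk⇒Contains : ∀ {k} (vs : Vec (Fin n) (suc k)) → Unique vs →
    (∀ i → lookup vs (inject₁ i) ~ lookup vs (suc i)) → Contains G (P (suc k))
  unique-walk⇒Contains vs distinct walk = lookup vs , lookup-injective distinct _ _ , edge
    where
    edge : ∀ i j → pathℕ (toℕ i) (toℕ j) ≡ true → lookup vs i ~ lookup vs j
    edge i j i~j with pathℕ-step i j i~j
    ... | inj₁ (l , refl , refl) = walk l
    ... | inj₂ (l , refl , refl) = ~-sym (walk l)

  degIn : VertexSet n → Fin n → ℕ
  degIn S v = ∑[ w < n ] ⟦ S w ∧ adj G v w ⟧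

  eIn : ℕ → VertexSet n → ℕ
  eIn p S = ∑[ v < n ] (if S v then degIn S v ^ p else 0)

  e≡eIn : ∀ p → e p G ≡ eIn p full
  e≡eIn p = trans (sum-map-allFin (λ v → deg G v ^ p))
                  (sum-cong-≗ (λ v → cong (_^ p) (sum-map-allFin (λ w → ⟦ adj G v w ⟧))))

  degIn-mono : ∀ {S T} → (∀ {v} → T v ≡ true → S v ≡ true) → ∀ v → degIn T v ≤ degIn S v
  degIn-mono {S} {T} T⊆S v = ∑-mono-≤ bound
    where
    bound : ∀ w → ⟦ T w ∧ adj G v w ⟧ ≤ ⟦ S w ∧ adj G v w ⟧
    bound w = ⟦⟧≤ _ λ Tw∧v~w → let (Tw , v~w) = ∧-elim Tw∧v~w in
      ≤-reflexive (sym (cong ⟦_⟧ (∧-intro (T⊆S Tw) v~w)))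

  degIn≤length : ∀ S v (ws : List (Fin n)) → (∀ {w} → S w ≡ true → v ~ w → w ∈ ws) → degIn S v ≤ length ws
  degIn≤length S v ws covered = ≤-trans (∑-mono-≤ bound) (≤-reflexive (∑-multiplicity ws))
    where
    bound : ∀ w → ⟦ S w ∧ adj G v w ⟧ ≤ multiplicity ws w
    bound w = ⟦⟧≤ _ λ Sw∧v~w → let (Sw , v~w) = ∧-elim Sw∧v~w in ∈⇒1≤multiplicity (covered Sw v~w)

  neighbour-∉ : ∀ S v (ws : List (Fin n)) → length ws < degIn S v → ∃ λ w → S w ≡ true × v ~ w × w ∉ ws
  neighbour-∉ S v ws ws<deg with any? (λ w → (S w ≟ᵇ true) ×-dec (adj G v w ≟ᵇ true) ×-dec ¬? (w ∈? ws))
  ... | yes found = found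
  ... | no none = ⊥-elim (<⇒≱ ws<deg (degIn≤length S v ws covered))
    where
    covered : ∀ {w} → S w ≡ true → v ~ w → w ∈ ws
    covered {w} Sw v~w with w ∈? ws
    ... | yes w∈ws = w∈ws
    ... | no w∉ws = ⊥-elim (none (w , Sw , v~w , w∉ws))

  2≤degIn : ∀ {S v a b} → S a ≡ true → v ~ a → S b ≡ true → v ~ b → a ≢ b → 2 ≤ degIn S v
  2≤degIn {S} {v} {a} {b} Sa v~a Sb v~b a≢b = begin
    2                             ≡⟨ sym (∑-multiplicity (a ∷ b ∷ [])) ⟩
    ∑ (multiplicity (a ∷ b ∷ [])) ≤⟨ ∑-mono-≤ bound ⟩
    degIn S v                     ∎
    where
    open ≤-Reasoning
    bound : ∀ w → δ w a + (δ w b + 0) ≤ ⟦ S w ∧ adj G v w ⟧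
    bound w with w ≟ a | w ≟ b
    ... | yes refl | yes refl = ⊥-elim (a≢b refl)
    ... | yes refl | no _ rewrite Sa | v~a = ≤-refl
    ... | no _ | yes refl rewrite Sb | v~b = ≤-refl
    ... | no _ | no _ = z≤n

  record Closed (S T : VertexSet n) : Set where
    field
      ⊆ : ∀ {v} → T v ≡ true → S v ≡ true
      closed : ∀ {v w} → T v ≡ true → S w ≡ true → v ~ w → T w ≡ true

  module _ {S T : VertexSet n} (T-closed : Closed S T) where
    open Closed T-closed

    degIn-inside : ∀ {v} → T v ≡ true → degIn S v ≡ degIn T v
    degIn-inside {v} Tv = sum-cong-≗ same
      where
      same : ∀ w → ⟦ S w ∧ adj G v w ⟧ ≡ ⟦ T w ∧ adj G v w ⟧
      same w with adj G v w in v~w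
      ... | false rewrite ∧-zeroʳ (S w) | ∧-zeroʳ (T w) = refl
      ... | true with T w in Tw
      ...   | true rewrite ⊆ Tw = refl
      ...   | false with S w in Sw
      ...     | true with () ← trans (sym (closed Tv Sw v~w)) Tw
      ...     | false = refl

    degIn-outside : ∀ {v} → S v ≡ true → T v ≡ false → degIn S v ≡ degIn (S ∖ T) v
    degIn-outside {v} Sv ¬Tv = sum-cong-≗ same
      where
      same : ∀ w → ⟦ S w ∧ adj G v w ⟧ ≡ ⟦ (S w ∧ not (T w)) ∧ adj G v w ⟧
      same w with adj G v w in v~w
      ... | false rewrite ∧-zeroʳ (S w) | ∧-zeroʳ (S w ∧ not (T w)) = refl
      ... | true with S w
      ...   | false = refl
      ...   | true with T w in Tw
      ...     | true with () ← trans (sym (closed Tw Sv (~-sym v~w))) ¬Tv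
      ...     | false = refl

    eIn-split : ∀ p → eIn p S ≡ eIn p T + eIn p (S ∖ T)
    eIn-split p = trans (sum-cong-≗ split) (∑-distrib-+ (λ v → if T v then degIn T v ^ p else 0)
                                                       (λ v → if (S ∖ T) v then degIn (S ∖ T) v ^ p else 0))
      where
      split : ∀ v → (if S v then degIn S v ^ p else 0)
                  ≡ (if T v then degIn T v ^ p else 0) + (if (S ∖ T) v then degIn (S ∖ T) v ^ p else 0)
      split v with T v in Tv
      ... | true rewrite ⊆ Tv = trans (cong (_^ p) (degIn-inside Tv)) (sym (+-identityʳ _))
      ... | false with S v in Sv
      ...   | true = cong (_^ p) (degIn-outside Sv Tv)
      ...   | false = refl

    ∣∣-split : ∣ S ∣ ≡ ∣ T ∣ + ∣ S ∖ T ∣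
    ∣∣-split = trans (sum-cong-≗ split) (∑-distrib-+ (λ v → ⟦ T v ⟧) (λ v → ⟦ (S ∖ T) v ⟧))
      where
      split : ∀ v → ⟦ S v ⟧ ≡ ⟦ T v ⟧ + ⟦ S v ∧ not (T v) ⟧
      split v with T v in Tv
      ... | true rewrite ⊆ Tv = refl
      ... | false with S v
      ...   | true = refl
      ...   | false = refl

  -- T spans H(∣T∣,5) with centre x and extra edge ab, and T has no further edges into S.
  record HShaped (S T : VertexSet n) : Set where
    field
      x a b : Fin n
      x~a : x ~ a
      x~b : x ~ b
      a~b : a ~ b
      x~ : ∀ {v} → T v ≡ true → v ≢ x → x ~ v
      leaf : ∀ {v w} → T v ≡ true → v ≢ x → v ≢ a → v ≢ b → S w ≡ true → v ~ w → w ≡ x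
      a-nbrs : ∀ {w} → S w ≡ true → a ~ w → w ≡ x ⊎ w ≡ b
      b-nbrs : ∀ {w} → S w ≡ true → b ~ w → w ≡ x ⊎ w ≡ a

  HShaped-restrict : ∀ {S T T'} → (∀ {v} → T' v ≡ true → T v ≡ true) → HShaped S T → HShaped S T'
  HShaped-restrict T'⊆T H = record
    { x = x ; a = a ; b = b ; x~a = x~a ; x~b = x~b ; a~b = a~b
    ; x~ = λ T'v → x~ (T'⊆T T'v) ; leaf = λ T'v → leaf (T'⊆T T'v) ; a-nbrs = a-nbrs ; b-nbrs = b-nbrs }
    where open HShaped H

module P₅Free {n} (G : Graph n) (P₅-free : Free (P 5) G) where
  open InducedSubgraph G

  no-P₅ : ∀ a b c d e → a ~ b → b ~ c → c ~ d → d ~ e →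
          a ≢ c → a ≢ d → a ≢ e → b ≢ d → b ≢ e → c ≢ e → ⊥
  no-P₅ a b c d e a~b b~c c~d d~e a≢c a≢d a≢e b≢d b≢e c≢e =
    P₅-free (unique-walk⇒Contains (a ∷ b ∷ c ∷ d ∷ e ∷ []) distinct walk)
    where
    distinct : Unique (a ∷ b ∷ c ∷ d ∷ e ∷ [])
    distinct = (~⇒≢ a~b ∷ a≢c ∷ a≢d ∷ a≢e ∷ []) ∷ (~⇒≢ b~c ∷ b≢d ∷ b≢e ∷ [])
             ∷ (~⇒≢ c~d ∷ c≢e ∷ []) ∷ (~⇒≢ d~e ∷ []) ∷ [] ∷ []
    walk : ∀ i → lookup (a ∷ b ∷ c ∷ d ∷ e ∷ []) (inject₁ i) ~ lookup (a ∷ b ∷ c ∷ d ∷ e ∷ []) (suc i)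
    walk zero = a~b
    walk (suc zero) = b~c
    walk (suc (suc zero)) = c~d
    walk (suc (suc (suc zero))) = d~e

  fourth-neighbour : ∀ {S x} → 4 ≤ degIn S x → ∀ a b c →
    ∃ λ y → S y ≡ true × x ~ y × y ≢ a × y ≢ b × y ≢ c
  fourth-neighbour {S} {x} 4≤Δ a b c with neighbour-∉ S x (a ∷ b ∷ c ∷ []) 4≤Δ
  ... | y , Sy , x~y , y∉abc =
    y , Sy , x~y , (λ y≡a → y∉abc (here y≡a)) , (λ y≡b → y∉abc (there (here y≡b)))
      , (λ y≡c → y∉abc (there (there (here y≡c))))

  module Extremal (q : ℕ) where

    p : ℕ
    p = 2 + q

    record Piece (S : VertexSet n) : Set where
      field
        T : VertexSet n
        T-closed : Closed S T
        5≤∣T∣ : 5 ≤ ∣ T ∣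
        bounded : eIn p T ≤ F p ∣ T ∣
        strict-or-H : eIn p T < F p ∣ T ∣ ⊎ HShaped S T

    -- Some neighbour u of x has a neighbour w outside N[x]: T = N[x] ∪ N(u) is a double star.
    module DoubleStar {S : VertexSet n} {x u w : Fin n}
        (4≤Δ : 4 ≤ degIn S x) (Sx : S x ≡ true) (Su : S u ≡ true) (x~u : x ~ u)
        (Sw : S w ≡ true) (u~w : u ~ w) (w≢x : w ≢ x) (x≁w : ¬ x ~ w) where

      x-leaf : ∀ {y z} → S y ≡ true → x ~ y → y ≢ u → S z ≡ true → y ~ z → z ≡ x
      x-leaf {y} {z} Sy x~y y≢u Sz y~z with z ≟ x
      ... | yes z≡x = z≡x
      ... | no z≢x with fourth-neighbour 4≤Δ u y w
      ...   | y' , _ , x~y' , y'≢u , y'≢y , y'≢w with z ≟ u | z ≟ w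
      ...     | yes refl | _ = ⊥-elim (no-P₅ w u y x y' (~-sym u~w) (~-sym y~z) (~-sym x~y) x~y'
                  (≁⇒≢ x≁w x~y) w≢x (≢-sym y'≢w)
                  (~⇒≢ (~-sym x~u)) (≢-sym y'≢u) (≢-sym y'≢y))
      ...     | no _ | yes refl = ⊥-elim (no-P₅ y' x y w u (~-sym x~y') x~y y~z (~-sym u~w)
                  y'≢y y'≢w y'≢u (≢-sym w≢x) (~⇒≢ x~u) y≢u)
      ...     | no z≢u | no z≢w = ⊥-elim (no-P₅ z y x u w (~-sym y~z) (~-sym x~y) x~u u~w
                  z≢x z≢u z≢w y≢u (≢-sym (≁⇒≢ x≁w x~y)) (≢-sym w≢x))

      u-nbr-≁x : ∀ {z} → S z ≡ true → u ~ z → z ≢ x → ¬ x ~ z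
      u-nbr-≁x Sz u~z z≢x x~z = ~⇒≢ x~u (sym (x-leaf Sz x~z (≢-sym (~⇒≢ u~z)) Su (~-sym u~z)))

      u-leaf : ∀ {z r} → S z ≡ true → u ~ z → z ≢ x → S r ≡ true → z ~ r → r ≡ u
      u-leaf {z} {r} Sz u~z z≢x Sr z~r with r ≟ u
      ... | yes r≡u = r≡u
      ... | no r≢u with r ≟ x
      ...   | yes refl = ⊥-elim (u-nbr-≁x Sz u~z z≢x (~-sym z~r))
      ...   | no r≢x with fourth-neighbour 4≤Δ u r z
      ...     | y' , _ , x~y' , y'≢u , y'≢r , y'≢z = ⊥-elim (no-P₅ r z u x y' (~-sym z~r) (~-sym u~z) (~-sym x~u) x~y'
                  r≢u r≢x (≢-sym y'≢r) z≢x (≁⇒≢ (u-nbr-≁x Sz u~z z≢x) x~y') (≢-sym y'≢u))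

      T : VertexSet n
      T v = S v ∧ (does (v ≟ x) ∨ adj G x v ∨ adj G u v)

      T-cases : ∀ {v} → T v ≡ true → S v ≡ true × (v ≡ x ⊎ x ~ v ⊎ u ~ v)
      T-cases {v} Tv with ∧-elim {S v} Tv
      ... | Sv , v∈N[x]∪N[u] = Sv , Sum.map (does-true (v ≟ x)) ∨-elim (∨-elim v∈N[x]∪N[u])

      x∈T : T x ≡ true
      x∈T = ∧-intro Sx (∨-introˡ _ (dec-true (x ≟ x) refl))

      x-nbrs⊆T : ∀ {v} → S v ≡ true → x ~ v → T v ≡ true
      x-nbrs⊆T {v} Sv x~v = ∧-intro Sv (∨-introʳ (does (v ≟ x)) (∨-introˡ (adj G u v) x~v))

      u-nbrs⊆T : ∀ {v} → S v ≡ true → u ~ v → T v ≡ true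
      u-nbrs⊆T {v} Sv u~v = ∧-intro Sv (∨-introʳ (does (v ≟ x)) (∨-introʳ (adj G x v) u~v))

      T-closed : Closed S T
      T-closed = record { ⊆ = λ Tv → proj₁ (T-cases Tv) ; closed = closed }
        where
        closed : ∀ {v z} → T v ≡ true → S z ≡ true → v ~ z → T z ≡ true
        closed {v} {z} Tv Sz v~z with T-cases Tv
        ... | _ , inj₁ refl = x-nbrs⊆T Sz v~z
        ... | Sv , inj₂ (inj₁ x~v) with v ≟ u
        ...   | yes refl = u-nbrs⊆T Sz v~z
        ...   | no v≢u rewrite x-leaf Sv x~v v≢u Sz v~z = x∈T
        closed {v} {z} Tv Sz v~z | Sv , inj₂ (inj₂ u~v) with v ≟ x
        ...   | yes refl = x-nbrs⊆T Sz v~z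
        ...   | no v≢x rewrite u-leaf Sv u~v v≢x Sz v~z = x-nbrs⊆T Su x~u

      Δ d : ℕ
      Δ = degIn S x
      d = degIn S u

      2≤d : 2 ≤ d
      2≤d = 2≤degIn Sx (~-sym x~u) Sw u~w (≢-sym w≢x)

      Δ+d≤∣T∣ : Δ + d ≤ ∣ T ∣
      Δ+d≤∣T∣ = ≤-trans (≤-reflexive (sym (∑-distrib-+ (λ v → ⟦ S v ∧ adj G x v ⟧) (λ v → ⟦ S v ∧ adj G u v ⟧))))
                        (∑-mono-≤ λ v → ⟦⟧+⟦⟧≤ _ _ _ (disjoint v) (into x-nbrs⊆T) (into u-nbrs⊆T))
        where
        disjoint : ∀ v → S v ∧ adj G x v ≡ true → S v ∧ adj G u v ≡ true → ⊥
        disjoint v Sv∧x~v Sv∧u~v with ∧-elim Sv∧x~v | ∧-elim Sv∧u~v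
        ... | Sv , x~v | _ , u~v = ~⇒≢ x~u (sym (x-leaf Sv x~v (≢-sym (~⇒≢ u~v)) Su (~-sym u~v)))
        into : ∀ {c v} → (S v ≡ true → c ~ v → T v ≡ true) → S v ∧ adj G c v ≡ true → T v ≡ true
        into c⊆T Sv∧c~v = let (Sv , c~v) = ∧-elim Sv∧c~v in c⊆T Sv c~v

      leaf-degree : ∀ {v} → T v ≡ true → v ≢ x → v ≢ u → degIn S v ≤ 1
      leaf-degree {v} Tv v≢x v≢u with T-cases Tv
      ... | _ , inj₁ v≡x = ⊥-elim (v≢x v≡x)
      ... | Sv , inj₂ (inj₁ x~v) = degIn≤length S v (x ∷ []) λ Sz v~z → here (x-leaf Sv x~v v≢u Sz v~z)
      ... | Sv , inj₂ (inj₂ u~v) = degIn≤length S v (u ∷ []) λ Sz v~z → here (u-leaf Sv u~v v≢x Sz v~z)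

      eIn-T≤ : eIn p T ≤ Δ ^ p + (d ^ p + ∣ T ∣)
      eIn-T≤ = ≤-trans (∑-mono-≤ pointwise)
        (≤-reflexive (trans (∑[cδ+f]≡c+∑f (Δ ^ p) x _) (cong (Δ ^ p +_) (∑[cδ+f]≡c+∑f (d ^ p) u _))))
        where
        pointwise : ∀ v → (if T v then degIn T v ^ p else 0) ≤ Δ ^ p * δ v x + (d ^ p * δ v u + ⟦ T v ⟧)
        pointwise v with T v in Tv
        ... | false = z≤n
        ... | true = by-cases (v ≟ x) (v ≟ u)
          where
          by-cases : Dec (v ≡ x) → Dec (v ≡ u) → degIn T v ^ p ≤ Δ ^ p * δ v x + (d ^ p * δ v u + 1)
          by-cases (yes refl) _ = ≤-trans (m≤c*δii x (^-monoˡ-≤ p (degIn-mono (Closed.⊆ T-closed) x))) (m≤m+n _ _)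
          by-cases (no _) (yes refl) = ≤-trans (m≤c*δii u (^-monoˡ-≤ p (degIn-mono (Closed.⊆ T-closed) u)))
                                                (≤-trans (m≤m+n _ 1) (m≤n+m _ (Δ ^ p * δ u x)))
          by-cases (no v≢x) (no v≢u) =
            ≤-trans (^-monoˡ-≤ p (≤-trans (degIn-mono (Closed.⊆ T-closed) v) (leaf-degree Tv v≢x v≢u)))
                    (≤-trans (≤-reflexive (^-zeroˡ p)) (≤-trans (m≤n+m 1 (d ^ p * δ v u)) (m≤n+m _ (Δ ^ p * δ v x))))

      piece : Piece S
      piece = record
        { T = T ; T-closed = T-closed ; 5≤∣T∣ = 5≤∣T∣ ; bounded = <⇒≤ strict ; strict-or-H = inj₁ strict }
        where
        strict : eIn p T < F p ∣ T ∣
        strict = ≤-<-trans eIn-T≤ (subst (_< F p ∣ T ∣) (+-assoc (Δ ^ p) _ _)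
                   (Δ^p+d^p+t<F q (≤-trans (s≤s (s≤s z≤n)) 4≤Δ) 2≤d Δ+d≤∣T∣))
        5≤∣T∣ : 5 ≤ ∣ T ∣
        5≤∣T∣ = ≤-trans (≤-trans (n≤1+n 5) (+-mono-≤ 4≤Δ 2≤d)) Δ+d≤∣T∣

    -- No vertex of S is at distance 2 from x, so T = N[x] is a union of components.
    module Star {S : VertexSet n} {x : Fin n} (4≤Δ : 4 ≤ degIn S x) (Sx : S x ≡ true)
        (N²⊆N : ∀ {u w} → S u ≡ true → x ~ u → S w ≡ true → u ~ w → w ≢ x → x ~ w) where

      T : VertexSet n
      T v = S v ∧ (does (v ≟ x) ∨ adj G x v)

      T-cases : ∀ {v} → T v ≡ true → S v ≡ true × (v ≡ x ⊎ x ~ v)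
      T-cases {v} Tv with ∧-elim {S v} Tv
      ... | Sv , v∈N[x] = Sv , Sum.map₁ (does-true (v ≟ x)) (∨-elim v∈N[x])

      N[x]⊆T : ∀ {v} → S v ≡ true → (v ≢ x → x ~ v) → T v ≡ true
      N[x]⊆T {v} Sv x~v with v ≟ x
      ... | yes _ = ∧-intro Sv refl
      ... | no v≢x = ∧-intro Sv (x~v v≢x)

      T-closed : Closed S T
      T-closed = record { ⊆ = λ Tv → proj₁ (T-cases Tv) ; closed = closed }
        where
        closed : ∀ {v z} → T v ≡ true → S z ≡ true → v ~ z → T z ≡ true
        closed {v} {z} Tv Sz v~z with T-cases Tv
        ... | _ , inj₁ refl = N[x]⊆T Sz (λ _ → v~z)
        ... | Sv , inj₂ x~v = N[x]⊆T Sz (N²⊆N Sv x~v Sz v~z)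

      Δ : ℕ
      Δ = degIn S x

      ∣T∣≡1+Δ : ∣ T ∣ ≡ 1 + Δ
      ∣T∣≡1+Δ = trans (sum-cong-≗ split) (trans (∑-distrib-+ (λ v → δ v x) (λ v → ⟦ S v ∧ adj G x v ⟧))
                                                 (cong (_+ Δ) (∑-δ x)))
        where
        split : ∀ v → ⟦ T v ⟧ ≡ δ v x + ⟦ S v ∧ adj G x v ⟧
        split v with v ≟ x
        ... | yes refl rewrite Sx | irrefl G x = refl
        ... | no _ = refl

      5≤∣T∣ : 5 ≤ ∣ T ∣
      5≤∣T∣ = ≤-trans (s≤s 4≤Δ) (≤-reflexive (sym ∣T∣≡1+Δ))

      x~T : ∀ {v} → T v ≡ true → v ≢ x → x ~ v
      x~T Tv v≢x with T-cases Tv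
      ... | _ , inj₁ v≡x = ⊥-elim (v≢x v≡x)
      ... | _ , inj₂ x~v = x~v

      1≤⟦x~v⟧ : ∀ {v} → T v ≡ true → v ≢ x → 1 ≤ ⟦ S v ∧ adj G x v ⟧
      1≤⟦x~v⟧ Tv v≢x = ≤-reflexive (sym (cong ⟦_⟧ (∧-intro (Closed.⊆ T-closed Tv) (x~T Tv v≢x))))

      triangle-nbrs : ∀ {a b} → S a ≡ true → x ~ a → S b ≡ true → x ~ b → a ~ b →
                      ∀ {z} → S z ≡ true → a ~ z → z ≡ x ⊎ z ≡ b
      triangle-nbrs {a} {b} Sa x~a Sb x~b a~b {z} Sz a~z with z ≟ x | z ≟ b
      ... | yes z≡x | _ = inj₁ z≡x
      ... | no _ | yes z≡b = inj₂ z≡b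
      ... | no z≢x | no z≢b with fourth-neighbour 4≤Δ z a b
      ...   | y , _ , x~y , y≢z , y≢a , y≢b = ⊥-elim (no-P₅ z a b x y (~-sym a~z) a~b (~-sym x~b) x~y
                  z≢b z≢x (≢-sym y≢z) (≢-sym (~⇒≢ x~a)) (≢-sym y≢a) (≢-sym y≢b))

      module Pure (no-edge : ∀ {a b} → S a ≡ true → x ~ a → S b ≡ true → x ~ b → ¬ a ~ b) where

        leaf-degree : ∀ {v} → T v ≡ true → v ≢ x → degIn S v ≤ 1
        leaf-degree {v} Tv v≢x = degIn≤length S v (x ∷ []) λ {z} Sz v~z →
          here (decidable-stable (z ≟ x) (λ z≢x → no-edge Sv x~v Sz (N²⊆N Sv x~v Sz v~z z≢x) v~z))
          where
          Sv : S v ≡ true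
          Sv = Closed.⊆ T-closed Tv
          x~v : x ~ v
          x~v = x~T Tv v≢x

        eIn-T≤ : eIn p T ≤ Δ ^ p + Δ
        eIn-T≤ = ≤-trans (∑-mono-≤ pointwise) (≤-reflexive (∑[cδ+f]≡c+∑f (Δ ^ p) x _))
          where
          pointwise : ∀ v → (if T v then degIn T v ^ p else 0) ≤ Δ ^ p * δ v x + ⟦ S v ∧ adj G x v ⟧
          pointwise v with T v in Tv
          ... | false = z≤n
          ... | true = by-cases (v ≟ x)
            where
            by-cases : Dec (v ≡ x) → degIn T v ^ p ≤ Δ ^ p * δ v x + ⟦ S v ∧ adj G x v ⟧
            by-cases (yes refl) = ≤-trans (m≤c*δii x (^-monoˡ-≤ p (degIn-mono (Closed.⊆ T-closed) x))) (m≤m+n _ _)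
            by-cases (no v≢x) =
              ≤-trans (^-monoˡ-≤ p (≤-trans (degIn-mono (Closed.⊆ T-closed) v) (leaf-degree Tv v≢x)))
                      (≤-trans (≤-reflexive (^-zeroˡ p)) (≤-trans (1≤⟦x~v⟧ Tv v≢x) (m≤n+m _ (Δ ^ p * δ v x))))

        piece : Piece S
        piece = record
          { T = T ; T-closed = T-closed ; 5≤∣T∣ = 5≤∣T∣ ; bounded = <⇒≤ strict ; strict-or-H = inj₁ strict }
          where
          strict : eIn p T < F p ∣ T ∣
          strict = ≤-<-trans eIn-T≤ (subst (λ t → Δ ^ p + Δ < F p t) (sym ∣T∣≡1+Δ) (Δ^p+Δ<F[1+Δ] q Δ))

      module Triangle {a b : Fin n} (Sa : S a ≡ true) (x~a : x ~ a) (Sb : S b ≡ true) (x~b : x ~ b) (a~b : a ~ b) where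

        leaf : ∀ {v z} → S v ≡ true → x ~ v → v ≢ a → v ≢ b → S z ≡ true → v ~ z → z ≡ x
        leaf {v} {z} Sv x~v v≢a v≢b Sz v~z with z ≟ x
        ... | yes z≡x = z≡x
        ... | no z≢x with fourth-neighbour 4≤Δ v a b
        ...   | y , _ , x~y , y≢v , y≢a , y≢b with z ≟ a | z ≟ b
        ...     | yes refl | _ = ⊥-elim (no-P₅ v a b x y v~z a~b (~-sym x~b) x~y
                    v≢b (≢-sym (~⇒≢ x~v)) (≢-sym y≢v) (≢-sym (~⇒≢ x~a)) (≢-sym y≢a) (≢-sym y≢b))
        ...     | no _ | yes refl = ⊥-elim (no-P₅ v b a x y v~z (~-sym a~b) (~-sym x~a) x~y
                    v≢a (≢-sym (~⇒≢ x~v)) (≢-sym y≢v) (≢-sym (~⇒≢ x~b)) (≢-sym y≢b) (≢-sym y≢a))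
        ...     | no z≢a | no z≢b = ⊥-elim (no-P₅ z v x a b (~-sym v~z) (~-sym x~v) x~a a~b
                    z≢x z≢a z≢b v≢a v≢b (~⇒≢ x~b))

        -- a and b contribute 2ᵖ = c + 1 each, the 1 being counted among the Δ neighbours of x.
        c : ℕ
        c = 2 ^ p ∸ 1

        2^p≡c+1 : 2 ^ p ≡ c + 1
        2^p≡c+1 = trans (sym (m+[n∸m]≡n (m^n>0 2 p))) (+-comm 1 c)

        degree-a≤2 : degIn S a ≤ 2
        degree-a≤2 = degIn≤length S a (x ∷ b ∷ []) λ Sz a~z →
          Sum.[ here , (λ z≡b → there (here z≡b)) ]′ (triangle-nbrs Sa x~a Sb x~b a~b Sz a~z)

        degree-b≤2 : degIn S b ≤ 2
        degree-b≤2 = degIn≤length S b (x ∷ a ∷ []) λ Sz b~z →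
          Sum.[ here , (λ z≡a → there (here z≡a)) ]′ (triangle-nbrs Sb x~b Sa x~a (~-sym a~b) Sz b~z)

        eIn-T≤ : eIn p T ≤ Δ ^ p + (c + (c + Δ))
        eIn-T≤ = ≤-trans (∑-mono-≤ pointwise)
          (≤-reflexive (trans (∑[cδ+f]≡c+∑f (Δ ^ p) x _)
                       (cong (Δ ^ p +_) (trans (∑[cδ+f]≡c+∑f c a _) (cong (c +_) (∑[cδ+f]≡c+∑f c b _))))))
          where
          pointwise : ∀ v → (if T v then degIn T v ^ p else 0)
                          ≤ Δ ^ p * δ v x + (c * δ v a + (c * δ v b + ⟦ S v ∧ adj G x v ⟧))
          pointwise v with T v in Tv
          ... | false = z≤n
          ... | true = by-cases (v ≟ x) (v ≟ a) (v ≟ b)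
            where
            degIn-T≤ : degIn T v ≤ degIn S v
            degIn-T≤ = degIn-mono (Closed.⊆ T-closed) v
            2^p≤c+⟦x~v⟧ : v ≢ x → 2 ^ p ≤ c * δ v v + ⟦ S v ∧ adj G x v ⟧
            2^p≤c+⟦x~v⟧ v≢x = ≤-trans (≤-reflexive 2^p≡c+1) (+-mono-≤ (m≤c*δii v ≤-refl) (1≤⟦x~v⟧ Tv v≢x))
            by-cases : Dec (v ≡ x) → Dec (v ≡ a) → Dec (v ≡ b) →
                       degIn T v ^ p ≤ Δ ^ p * δ v x + (c * δ v a + (c * δ v b + ⟦ S v ∧ adj G x v ⟧))
            by-cases (yes refl) _ _ = ≤-trans (m≤c*δii x (^-monoˡ-≤ p degIn-T≤)) (m≤m+n _ _)
            by-cases (no v≢x) (yes refl) _ =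
              ≤-trans (^-monoˡ-≤ p (≤-trans degIn-T≤ degree-a≤2))
                (≤-trans (2^p≤c+⟦x~v⟧ v≢x)
                  (≤-trans (+-monoʳ-≤ (c * δ a a) (m≤n+m _ (c * δ a b))) (m≤n+m _ (Δ ^ p * δ a x))))
            by-cases (no v≢x) (no _) (yes refl) =
              ≤-trans (^-monoˡ-≤ p (≤-trans degIn-T≤ degree-b≤2))
                (≤-trans (2^p≤c+⟦x~v⟧ v≢x) (≤-trans (m≤n+m _ (c * δ b a)) (m≤n+m _ (Δ ^ p * δ b x))))
            by-cases (no v≢x) (no v≢a) (no v≢b) =
              ≤-trans (^-monoˡ-≤ p (≤-trans degIn-T≤ (degIn≤length S v (x ∷ []) λ Sz v~z →
                                       here (leaf (Closed.⊆ T-closed Tv) (x~T Tv v≢x) v≢a v≢b Sz v~z))))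
                (≤-trans (≤-reflexive (^-zeroˡ p))
                  (≤-trans (1≤⟦x~v⟧ Tv v≢x)
                    (≤-trans (m≤n+m _ (c * δ v b)) (≤-trans (m≤n+m _ (c * δ v a)) (m≤n+m _ (Δ ^ p * δ v x))))))

        H : HShaped S T
        H = record
          { x = x ; a = a ; b = b ; x~a = x~a ; x~b = x~b ; a~b = a~b ; x~ = x~T
          ; leaf = λ Tv v≢x → leaf (Closed.⊆ T-closed Tv) (x~T Tv v≢x)
          ; a-nbrs = triangle-nbrs Sa x~a Sb x~b a~b
          ; b-nbrs = triangle-nbrs Sb x~b Sa x~a (~-sym a~b) }

        piece : Piece S
        piece = record
          { T = T ; T-closed = T-closed ; 5≤∣T∣ = 5≤∣T∣ ; bounded = bounded ; strict-or-H = inj₂ H }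
          where
          bounded : eIn p T ≤ F p ∣ T ∣
          bounded = ≤-trans eIn-T≤ (≤-reflexive (begin
            Δ ^ p + (c + (c + Δ)) ≡⟨ regroup (Δ ^ p) c Δ ⟩
            Δ ^ p + Δ + 2 * c     ≡⟨ sym (F[1+Δ]≡Δ^p+Δ+2[2^p∸1] q (≤-trans (s≤s (s≤s z≤n)) 4≤Δ)) ⟩
            F p (1 + Δ)           ≡⟨ cong (F p) (sym ∣T∣≡1+Δ) ⟩
            F p ∣ T ∣             ∎))
            where
            open ≡-Reasoning
            regroup : ∀ X c Δ → X + (c + (c + Δ)) ≡ X + Δ + 2 * c
            regroup = solve-∀

    piece : ∀ {S x} → S x ≡ true → 4 ≤ degIn S x → Piece S
    piece {S} {x} Sx 4≤Δ with any? (λ u → (S u ≟ᵇ true) ×-dec (adj G x u ≟ᵇ true) ×-dec any? λ w →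
                               (S w ≟ᵇ true) ×-dec (adj G u w ≟ᵇ true) ×-dec ¬? (w ≟ x) ×-dec ¬? (adj G x w ≟ᵇ true))
    ... | yes (u , Su , x~u , w , Sw , u~w , w≢x , x≁w) = DoubleStar.piece 4≤Δ Sx Su x~u Sw u~w w≢x x≁w
    ... | no ¬double-star = star-piece N²⊆N
      where
      N²⊆N : ∀ {u w} → S u ≡ true → x ~ u → S w ≡ true → u ~ w → w ≢ x → x ~ w
      N²⊆N Su x~u Sw u~w w≢x = decidable-stable (_ ≟ᵇ true) λ x≁w →
        ¬double-star (_ , Su , x~u , _ , Sw , u~w , w≢x , x≁w)
      star-piece : (∀ {u w} → S u ≡ true → x ~ u → S w ≡ true → u ~ w → w ≢ x → x ~ w) → Piece S
      star-piece N²⊆N with any? (λ a → (S a ≟ᵇ true) ×-dec (adj G x a ≟ᵇ true) ×-dec any? λ b →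
                                 (S b ≟ᵇ true) ×-dec (adj G x b ≟ᵇ true) ×-dec (adj G a b ≟ᵇ true))
      ... | yes (a , Sa , x~a , b , Sb , x~b , a~b) = Star.Triangle.piece 4≤Δ Sx N²⊆N Sa x~a Sb x~b a~b
      ... | no ¬triangle = Star.Pure.piece 4≤Δ Sx N²⊆N λ Sa x~a Sb x~b a~b →
                             ¬triangle (_ , Sa , x~a , _ , Sb , x~b , a~b)

    max-degree : ∀ S → (∃ λ x → S x ≡ true × 4 ≤ degIn S x) ⊎ (∀ {v} → S v ≡ true → degIn S v ≤ 3)
    max-degree S with any? (λ x → (S x ≟ᵇ true) ×-dec (4 ≤? degIn S x))
    ... | yes large = inj₁ large
    ... | no ¬large = inj₂ λ {v} Sv → ≤-pred (≰⇒> λ 4≤deg → ¬large (v , Sv , 4≤deg))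

    eIn≤3^p∣S∣ : ∀ S → (∀ {v} → S v ≡ true → degIn S v ≤ 3) → eIn p S ≤ 3 ^ p * ∣ S ∣
    eIn≤3^p∣S∣ S Δ≤3 = ≤-trans (∑-mono-≤ pointwise) (≤-reflexive (sym (*-distribˡ-sum (3 ^ p) (λ v → ⟦ S v ⟧))))
      where
      pointwise : ∀ v → (if S v then degIn S v ^ p else 0) ≤ 3 ^ p * ⟦ S v ⟧
      pointwise v with S v in Sv
      ... | false = z≤n
      ... | true = ≤-trans (^-monoˡ-≤ p (Δ≤3 Sv)) (≤-reflexive (sym (*-identityʳ _)))

    eIn≤Φ : ∀ S → eIn p S ≤ Φ p ∣ S ∣
    eIn≤Φ S = bounded (suc ∣ S ∣) S ≤-refl
      where
      bounded : ∀ k S → ∣ S ∣ < k → eIn p S ≤ Φ p ∣ S ∣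
      bounded (suc k) S ∣S∣<1+k with max-degree S
      ... | inj₂ Δ≤3 = ≤-trans (eIn≤3^p∣S∣ S Δ≤3) (3^pk≤Φ p ∣ S ∣)
      ... | inj₁ (x , Sx , 4≤Δ) = begin
          eIn p S                       ≡⟨ eIn-split T-closed p ⟩
          eIn p T + eIn p (S ∖ T)       ≤⟨ +-monoˡ-≤ (eIn p (S ∖ T)) bounded-T ⟩
          F p ∣ T ∣ + eIn p (S ∖ T)     ≤⟨ +-monoʳ-≤ (F p ∣ T ∣) (bounded k (S ∖ T) ∣S∖T∣<k) ⟩
          F p ∣ T ∣ + Φ p ∣ S ∖ T ∣     ≤⟨ F+Φ≤Φ q ∣ S ∖ T ∣ 5≤∣T∣ ⟩
          Φ p (∣ T ∣ + ∣ S ∖ T ∣)       ≡⟨ cong (Φ p) (sym (∣∣-split T-closed)) ⟩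
          Φ p ∣ S ∣                     ∎
        where
        open ≤-Reasoning
        open Piece (piece Sx 4≤Δ) renaming (bounded to bounded-T)
        ∣S∖T∣<k : ∣ S ∖ T ∣ < k
        ∣S∖T∣<k = <-≤-trans (m<n+m ∣ S ∖ T ∣ (≤-trans (s≤s z≤n) 5≤∣T∣))
                            (≤-trans (≤-reflexive (sym (∣∣-split T-closed))) (≤-pred ∣S∣<1+k))

    extremal-piece : (P : Piece full) → F p n ≤ eIn p full → HShaped full full
    extremal-piece P F≤e = from-rest ∣ full ∖ T ∣ refl
      where
      open Piece P
      n≡∣T∣+∣R∣ : n ≡ ∣ T ∣ + ∣ full ∖ T ∣
      n≡∣T∣+∣R∣ = trans (sym (∣full∣≡n {n})) (∣∣-split T-closed)
      eIn≤eIn-T+Φ : eIn p full ≤ eIn p T + Φ p ∣ full ∖ T ∣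
      eIn≤eIn-T+Φ = ≤-trans (≤-reflexive (eIn-split T-closed p)) (+-monoʳ-≤ (eIn p T) (eIn≤Φ (full ∖ T)))
      from-rest : ∀ r → ∣ full ∖ T ∣ ≡ r → HShaped full full
      from-rest (suc r) ∣R∣≡1+r = ⊥-elim (<⇒≱ (begin-strict
        eIn p full                     ≤⟨ ≤-trans eIn≤eIn-T+Φ (+-monoˡ-≤ _ bounded) ⟩
        F p ∣ T ∣ + Φ p ∣ full ∖ T ∣   <⟨ F+Φ<F q 5≤∣T∣ (≤-trans (s≤s z≤n) (≤-reflexive (sym ∣R∣≡1+r))) ⟩
        F p (∣ T ∣ + ∣ full ∖ T ∣)     ≡⟨ cong (F p) (sym n≡∣T∣+∣R∣) ⟩
        F p n                          ∎) F≤e)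
        where open ≤-Reasoning
      from-rest zero ∣R∣≡0 with strict-or-H
      ... | inj₁ eIn-T<F = ⊥-elim (<⇒≱ (begin-strict
        eIn p full                     ≤⟨ eIn≤eIn-T+Φ ⟩
        eIn p T + Φ p ∣ full ∖ T ∣     ≡⟨ cong (λ r → eIn p T + Φ p r) ∣R∣≡0 ⟩
        eIn p T + 0                    ≡⟨ +-identityʳ _ ⟩
        eIn p T                        <⟨ eIn-T<F ⟩
        F p ∣ T ∣                      ≡⟨ cong (F p) (sym (trans n≡∣T∣+∣R∣ (trans (cong (∣ T ∣ +_) ∣R∣≡0) (+-identityʳ _)))) ⟩
        F p n                          ∎) F≤e)
        where open ≤-Reasoning
      ... | inj₂ H = HShaped-restrict (λ {v} _ → T-everything v) H
        where
        T-everything : ∀ v → T v ≡ true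
        T-everything v with T v | f≤∑f (λ v → ⟦ (full ∖ T) v ⟧) v
        ... | true | _ = refl
        ... | false | 1≤∣R∣ with () ← ≤-trans 1≤∣R∣ (≤-reflexive ∣R∣≡0)

    F≤eIn⇒HShaped : 12 ≤ n → F p n ≤ eIn p full → HShaped full full
    F≤eIn⇒HShaped 12≤n F≤e with max-degree full
    ... | inj₁ (x , _ , 4≤Δ) = extremal-piece (piece refl 4≤Δ) F≤e
    ... | inj₂ Δ≤3 = ⊥-elim (<⇒≱ (≤-<-trans (eIn≤3^p∣S∣ full Δ≤3) 3^p∣full∣<F) F≤e)
      where
      3^p∣full∣<F : 3 ^ p * ∣ full {n} ∣ < F p n
      3^p∣full∣<F = subst (λ t → 3 ^ p * t < F p n) (sym (∣full∣≡n {n})) (3^pt<F q 12≤n)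

no-injection-below : ∀ {m} (f : Fin (suc m) → ℕ) → (∀ i → f i < m) → ¬ Injective _≡_ _≡_ f
no-injection-below {m} f f<m f-injective with pigeonhole (n<1+n m) (λ i → fromℕ< (f<m i))
... | i , j , i<j , same = Fin.<-irrefl (f-injective (trans (sym (toℕ-fromℕ< (f<m i)))
                                                     (trans (cong toℕ same) (toℕ-fromℕ< (f<m j))))) i<j

hℕ-leaf : ∀ a b → hℕ a b ≡ true → 3 ≤ a → b ≡ 0
hℕ-leaf (suc (suc (suc _))) zero _ _ = refl
hℕ-leaf (suc (suc (suc _))) (suc zero) () _
hℕ-leaf (suc (suc (suc _))) (suc (suc _)) () _
hℕ-leaf (suc zero) _ _ (s≤s ())
hℕ-leaf (suc (suc zero)) _ _ (s≤s (s≤s ()))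

inner-vertex<3 : ∀ {a b c} → hℕ a b ≡ true → hℕ b c ≡ true → a ≢ c → b < 3
inner-vertex<3 {a} {b} {c} a~b b~c a≢c with b <? 3
... | yes b<3 = b<3
... | no b≮3 = ⊥-elim (a≢c (trans (hℕ-leaf b a (trans (hℕ-sym b a) a~b) 3≤b) (sym (hℕ-leaf b c b~c 3≤b))))
  where
  3≤b : 3 ≤ b
  3≤b = ≤-pred (≰⇒> b≮3)

-- The inner vertices v₁, v₂, v₃ of a P₅ in H(n,5) lie in {0,1,2}.  So does an end vertex, which
-- pigeonholes four vertices into {0,1,2}, or else both ends are leaves and v₁ = 0 = v₃.
H5-P₅-free : ∀ n → Free (P 5) (H5 n)
H5-P₅-free n (f , f-injective , edge) = by-ends (v 0F <? 3) (v 4F <? 3)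
  where
  v : Fin 5 → ℕ
  v i = toℕ (f i)
  v-injective : ∀ {i j} → v i ≡ v j → i ≡ j
  v-injective = f-injective ∘ toℕ-injective
  distinct : ∀ i j → i ≢ j → v i ≢ v j
  distinct i j i≢j = i≢j ∘ v-injective
  v1<3 : v 1F < 3
  v1<3 = inner-vertex<3 (edge 0F 1F refl) (edge 1F 2F refl) (distinct 0F 2F (λ ()))
  v2<3 : v 2F < 3
  v2<3 = inner-vertex<3 (edge 1F 2F refl) (edge 2F 3F refl) (distinct 1F 3F (λ ()))
  v3<3 : v 3F < 3
  v3<3 = inner-vertex<3 (edge 2F 3F refl) (edge 3F 4F refl) (distinct 2F 4F (λ ()))
  by-ends : Dec (v 0F < 3) → Dec (v 4F < 3) → ⊥
  by-ends (yes v0<3) _ = no-injection-below (v ∘ inject₁) (λ { 0F → v0<3 ; 1F → v1<3 ; 2F → v2<3 ; 3F → v3<3 })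
                           (inject₁-injective ∘ v-injective)
  by-ends _ (yes v4<3) = no-injection-below (v ∘ suc) (λ { 0F → v1<3 ; 1F → v2<3 ; 2F → v3<3 ; 3F → v4<3 })
                           (Fin.suc-injective ∘ v-injective)
  by-ends (no v0≮3) (no v4≮3) = distinct 1F 3F (λ ())
    (trans (hℕ-leaf (v 0F) (v 1F) (edge 0F 1F refl) (≤-pred (≰⇒> v0≮3)))
           (sym (hℕ-leaf (v 4F) (v 3F) (trans (hℕ-sym (v 4F) (v 3F)) (edge 3F 4F refl)) (≤-pred (≰⇒> v4≮3)))))

F≤e[H5] : ∀ p k → F p (3 + k) ≤ e p (H5 (3 + k))
F≤e[H5] p k = begin
  (2 + k) ^ p + 2 * 2 ^ p + k                ≡⟨ regroup ((2 + k) ^ p) (2 ^ p) k ⟩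
  (2 + k) ^ p + (2 ^ p + (2 ^ p + k))        ≤⟨ +-mono-≤ (≤-reflexive (cong (_^ p) (sym degree-0)))
                                                  (+-mono-≤ (^-monoˡ-≤ p degree-1) (+-mono-≤ (^-monoˡ-≤ p degree-2) leaves)) ⟩
  eIn p full                                 ≡⟨ sym (e≡eIn p) ⟩
  e p (H5 (3 + k))                           ∎
  where
  open ≤-Reasoning
  open InducedSubgraph (H5 (3 + k))
  degree-0 : degIn full 0F ≡ 2 + k
  degree-0 = trans (∑-const (2 + k) 1) (*-identityʳ (2 + k))
  degree-1 : 2 ≤ degIn full 1F
  degree-1 = 2≤degIn {S = full} {1F} {0F} {2F} refl refl refl refl (λ ())
  degree-2 : 2 ≤ degIn full 2F
  degree-2 = 2≤degIn {S = full} {2F} {0F} {1F} refl refl refl refl (λ ())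
  leaves : k ≤ ∑[ j < k ] (degIn full (suc (suc (suc j))) ^ p)
  leaves = ≤-trans (≤-reflexive (sym (trans (∑-const k 1) (*-identityʳ k))))
                   (∑-mono-≤ λ j → ≤-trans (≤-reflexive (sym (^-zeroˡ p)))
                                           (^-monoˡ-≤ p (f≤∑f (λ w → ⟦ adj (H5 (3 + k)) (suc (suc (suc j))) w ⟧) 0F)))
  regroup : ∀ X W k → X + 2 * W + k ≡ X + (W + (W + k))
  regroup = solve-∀

⟨$⟩ʳ-injective : ∀ {m} (π : Permutation′ m) {i j} → π ⟨$⟩ʳ i ≡ π ⟨$⟩ʳ j → i ≡ j
⟨$⟩ʳ-injective π {i} {j} πi≡πj = trans (sym (inverseˡ π)) (trans (cong (π ⟨$⟩ˡ_) πi≡πj) (inverseˡ π))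

transpose-matchˡ : ∀ {m} (i j : Fin m) → transpose i j ⟨$⟩ʳ i ≡ j
transpose-matchˡ i j with i ≟ i
... | yes _ = refl
... | no i≢i = ⊥-elim (i≢i refl)

transpose-other : ∀ {m} {i j k : Fin m} → k ≢ i → k ≢ j → transpose i j ⟨$⟩ʳ k ≡ k
transpose-other {i = i} {j} {k} k≢i k≢j with k ≟ i
... | yes k≡i = ⊥-elim (k≢i k≡i)
... | no _ with k ≟ j
...   | yes k≡j = ⊥-elim (k≢j k≡j)
...   | no _ = refl

move-to-012 : ∀ {k} {x a b : Fin (3 + k)} → x ≢ a → x ≢ b → a ≢ b →
  ∃ λ (σ : Permutation′ (3 + k)) → σ ⟨$⟩ʳ x ≡ 0F × σ ⟨$⟩ʳ a ≡ 1F × σ ⟨$⟩ʳ b ≡ 2F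
move-to-012 {k} {x} {a} {b} x≢a x≢b a≢b = τ₁ ∘ₚ τ₂ ∘ₚ τ₃ , σx≡0 , σa≡1 , transpose-matchˡ b₂ 2F
  where
  τ₁ τ₂ τ₃ : Permutation′ (3 + k)
  a₁ b₂ : Fin (3 + k)
  τ₁ = transpose x 0F
  a₁ = τ₁ ⟨$⟩ʳ a
  τ₂ = transpose a₁ 1F
  b₂ = τ₂ ⟨$⟩ʳ (τ₁ ⟨$⟩ʳ b)
  τ₃ = transpose b₂ 2F
  τ₂τ₁x≡0 : τ₂ ⟨$⟩ʳ (τ₁ ⟨$⟩ʳ x) ≡ 0F
  τ₂τ₁x≡0 = trans (cong (τ₂ ⟨$⟩ʳ_) (transpose-matchˡ x 0F))
                  (transpose-other (λ 0≡a₁ → x≢a (⟨$⟩ʳ-injective τ₁ (trans (transpose-matchˡ x 0F) 0≡a₁))) (λ ()))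
  σx≡0 : τ₃ ⟨$⟩ʳ (τ₂ ⟨$⟩ʳ (τ₁ ⟨$⟩ʳ x)) ≡ 0F
  σx≡0 = trans (cong (τ₃ ⟨$⟩ʳ_) τ₂τ₁x≡0)
               (transpose-other (λ 0≡b₂ → x≢b (⟨$⟩ʳ-injective τ₁ (⟨$⟩ʳ-injective τ₂ (trans τ₂τ₁x≡0 0≡b₂)))) (λ ()))
  σa≡1 : τ₃ ⟨$⟩ʳ (τ₂ ⟨$⟩ʳ (τ₁ ⟨$⟩ʳ a)) ≡ 1F
  σa≡1 = trans (cong (τ₃ ⟨$⟩ʳ_) (transpose-matchˡ a₁ 1F))
               (transpose-other (λ 1≡b₂ → a≢b (⟨$⟩ʳ-injective τ₁ (⟨$⟩ʳ-injective τ₂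
                                  (trans (transpose-matchˡ a₁ 1F) 1≡b₂)))) (λ ()))

module _ {k} (G : Graph (3 + k)) where
  open InducedSubgraph G

  HShaped⇒≅H5 : HShaped full full → G ≅ H5 (3 + k)
  HShaped⇒≅H5 H = σ , λ i j → adj-by-position (position i) (position j)
    where
    open HShaped H
    σ : Permutation′ (3 + k)
    σ = proj₁ (move-to-012 (~⇒≢ x~a) (~⇒≢ x~b) (~⇒≢ a~b))
    σx≡0 : σ ⟨$⟩ʳ x ≡ 0F
    σx≡0 = proj₁ (proj₂ (move-to-012 (~⇒≢ x~a) (~⇒≢ x~b) (~⇒≢ a~b)))
    σa≡1 : σ ⟨$⟩ʳ a ≡ 1F
    σa≡1 = proj₁ (proj₂ (proj₂ (move-to-012 (~⇒≢ x~a) (~⇒≢ x~b) (~⇒≢ a~b))))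
    σb≡2 : σ ⟨$⟩ʳ b ≡ 2F
    σb≡2 = proj₂ (proj₂ (proj₂ (move-to-012 (~⇒≢ x~a) (~⇒≢ x~b) (~⇒≢ a~b))))

    data Position (i : Fin (3 + k)) : Set where
      at-x : i ≡ x → σ ⟨$⟩ʳ i ≡ 0F → Position i
      at-a : i ≡ a → σ ⟨$⟩ʳ i ≡ 1F → Position i
      at-b : i ≡ b → σ ⟨$⟩ʳ i ≡ 2F → Position i
      at-leaf : ∀ y → i ≢ x → i ≢ a → i ≢ b → σ ⟨$⟩ʳ i ≡ suc (suc (suc y)) → Position i

    position : ∀ i → Position i
    position i with σ ⟨$⟩ʳ i in σi
    ... | 0F = at-x (⟨$⟩ʳ-injective σ (trans σi (sym σx≡0))) σi
    ... | 1F = at-a (⟨$⟩ʳ-injective σ (trans σi (sym σa≡1))) σi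
    ... | 2F = at-b (⟨$⟩ʳ-injective σ (trans σi (sym σb≡2))) σi
    ... | suc (suc (suc y)) = at-leaf y (avoid σx≡0 λ ()) (avoid σa≡1 λ ()) (avoid σb≡2 λ ()) σi
      where
      avoid : ∀ {z l} → σ ⟨$⟩ʳ z ≡ l → l ≢ suc (suc (suc y)) → i ≢ z
      avoid σz≡l l≢σi refl = l≢σi (trans (sym σz≡l) σi)

    not-adjacent : ∀ {i j} → ¬ i ~ j → adj G i j ≡ false
    not-adjacent = ¬-not

    adj-by-position : ∀ {i j} → Position i → Position j → adj G i j ≡ hℕ (toℕ (σ ⟨$⟩ʳ i)) (toℕ (σ ⟨$⟩ʳ j))
    adj-by-position (at-x refl σi) (at-x refl _) rewrite σi = irrefl G x
    adj-by-position (at-x refl σi) (at-a refl σj) rewrite σi | σj = x~a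
    adj-by-position (at-x refl σi) (at-b refl σj) rewrite σi | σj = x~b
    adj-by-position (at-x refl σi) (at-leaf _ j≢x _ _ σj) rewrite σi | σj = x~ refl j≢x
    adj-by-position (at-a refl σi) (at-x refl σj) rewrite σi | σj = ~-sym x~a
    adj-by-position (at-a refl σi) (at-a refl _) rewrite σi = irrefl G a
    adj-by-position (at-a refl σi) (at-b refl σj) rewrite σi | σj = a~b
    adj-by-position (at-a refl σi) (at-leaf _ j≢x _ j≢b σj) rewrite σi | σj =
      not-adjacent λ a~j → Sum.[ j≢x , j≢b ]′ (a-nbrs refl a~j)
    adj-by-position (at-b refl σi) (at-x refl σj) rewrite σi | σj = ~-sym x~b
    adj-by-position (at-b refl σi) (at-a refl σj) rewrite σi | σj = ~-sym a~b
    adj-by-position (at-b refl σi) (at-b refl _) rewrite σi = irrefl G b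
    adj-by-position (at-b refl σi) (at-leaf _ j≢x j≢a _ σj) rewrite σi | σj =
      not-adjacent λ b~j → Sum.[ j≢x , j≢a ]′ (b-nbrs refl b~j)
    adj-by-position (at-leaf _ i≢x _ _ σi) (at-x refl σj) rewrite σi | σj = ~-sym (x~ refl i≢x)
    adj-by-position (at-leaf _ i≢x i≢a i≢b σi) (at-a refl σj) rewrite σi | σj =
      not-adjacent λ i~a → ~⇒≢ x~a (sym (leaf refl i≢x i≢a i≢b refl i~a))
    adj-by-position (at-leaf _ i≢x i≢a i≢b σi) (at-b refl σj) rewrite σi | σj =
      not-adjacent λ i~b → ~⇒≢ x~b (sym (leaf refl i≢x i≢a i≢b refl i~b))
    adj-by-position (at-leaf _ i≢x i≢a i≢b σi) (at-leaf _ j≢x _ _ σj) rewrite σi | σj =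
      not-adjacent λ i~j → j≢x (leaf refl i≢x i≢a i≢b refl i~j)

lemma3p4 : (p : ℕ) → 2 ≤ p → (n : ℕ) → 12 ≤ n →
    (Free (P 5) (H5 n)
      × (∀ (G : Graph n) → Free (P 5) G → e p G ≤ e p (H5 n)))
    × (∀ (G : Graph n) → Free (P 5) G → e p G ≡ e p (H5 n) → G ≅ H5 n)
lemma3p4 p@(suc (suc q)) (s≤s (s≤s _)) n@(suc (suc (suc k))) 12≤n@(s≤s (s≤s (s≤s _))) =
  (H5-P₅-free n , e≤e[H5]) , e≡e[H5]⇒≅
  where
  e≤e[H5] : ∀ G → Free (P 5) G → e p G ≤ e p (H5 n)
  e≤e[H5] G P₅-free = begin
    e p G            ≡⟨ e≡eIn p ⟩
    eIn p full       ≤⟨ eIn≤Φ full ⟩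
    Φ p ∣ full {n} ∣ ≡⟨ cong (Φ p) (∣full∣≡n {n}) ⟩
    Φ p n            ≡⟨ Φ≡F q 12≤n ⟩
    F p n            ≤⟨ F≤e[H5] p k ⟩
    e p (H5 n)       ∎
    where
    open ≤-Reasoning
    open InducedSubgraph G
    open P₅Free.Extremal G P₅-free q hiding (p)
  e≡e[H5]⇒≅ : ∀ G → Free (P 5) G → e p G ≡ e p (H5 n) → G ≅ H5 n
  e≡e[H5]⇒≅ G P₅-free e≡e[H5] =
    HShaped⇒≅H5 G (F≤eIn⇒HShaped 12≤n (≤-trans (F≤e[H5] p k) (≤-reflexive (trans (sym e≡e[H5]) (e≡eIn p)))))
    where
    open InducedSubgraph G
    open P₅Free.Extremal G P₅-free q hiding (p)
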